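{- Let $\ell\in\mathbb{N}$ and let $1\le k\le n$ be integers. Let $z=(z_1,z_2,\dots)$ be the sequence with $z_i=i!$ for all $i\ne\ell+1$ and $z_{\ell+1}=0$. Then $$B_{n,k}(z)=\frac{n!}{k!}\left(\sum_{\kappa=0}^{k-1}(-1)^\kappa\binom{k}{\kappa}\binom{n-(\ell+1)\kappa-1}{k-\kappa-1}+(-1)^k\delta_{n,(\ell+1)k}\right),$$ where $\delta$ is the Kronecker delta.
   Context: $B_{n,k}$ denotes the $(n,k)$-th partial Bell polynomial: $B_{n,k}(z_1,\dots,z_{n-k+1})=\sum_{\alpha}\frac{n!}{\alpha_1!\cdots\alpha_{n-k+1}!}\prod_{i}\big(\frac{z_i}{i!}\big)^{\alpha_i}$, summed over $\alpha\in\mathbb{N}_0^{n-k+1}$ with $\sum_i\alpha_i=k$ and $\sum_i i\alpha_i=n$; with an infinite sequence as argument only the first $n-k+1$ entries are used. Binomial coefficients $\binom{a}{j}$ are taken to be $0$ unless $0\le j\le a$. -}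

module Defs where

open import Data.Nat as ℕ using (ℕ; zero; suc; _∸_; _≟_)
open import Data.Nat.Combinatorics using (_C_)
open import Data.Nat.Properties using (_!≢0)
import Data.Nat.Base as NB
open import Data.Integer as ℤ using (ℤ; +_)
open import Data.Rational as ℚ using (ℚ; _+_; _*_; _÷_; _-_; 0ℚ; 1ℚ)
open import Data.Rational.Base using (-_; _/_)
open import Data.List as List using (List; []; _∷_; upTo; concatMap; filter; map; foldr)
open import Data.Vec as Vec using (Vec; []; _∷_)
open import Data.Product using (_×_; _,_)
open import Relation.Nullary.Decidable using (_×-dec_; yes; no)

ℕ→ℚ : ℕ → ℚ
ℕ→ℚ n = + n / 1

invFact : ℕ → ℚ
invFact n = (+ 1 / (n NB.!)) {{n !≢0}}

_^ℚ_ : ℚ → ℕ → ℚ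
q ^ℚ zero = 1ℚ
q ^ℚ suc e = q * (q ^ℚ e)

boundedVecs : (m b : ℕ) → List (Vec ℕ m)
boundedVecs zero b = [] ∷ []
boundedVecs (suc m) b =
  concatMap (λ a → map (a ∷_) (boundedVecs m b)) (upTo (suc b))

sumV : ∀ {m} → Vec ℕ m → ℕ
sumV [] = 0
sumV (a ∷ v) = a NB.+ sumV v

wsumFrom : ∀ {m} → ℕ → Vec ℕ m → ℕ
wsumFrom s [] = 0
wsumFrom s (a ∷ v) = s NB.* a NB.+ wsumFrom (suc s) v

admissible : (n k : ℕ) → List (Vec ℕ (suc n ∸ k))
admissible n k =
  filter (λ α → (sumV α ≟ k) ×-dec (wsumFrom 1 α ≟ n)) (boundedVecs (suc n ∸ k) n)

termFrom : ℕ → (ℕ → ℚ) → ∀ {m} → Vec ℕ m → ℚ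
termFrom s z [] = 1ℚ
termFrom s z (a ∷ v) =
  (((z s * invFact s) ^ℚ a) * invFact a) * termFrom (suc s) z v

-- partial Bell polynomial B_{n,k}(z_1,…,z_{n-k+1}); the sequence z is
-- given as a function ℕ → ℚ with z i standing for z_i (z 0 unused).
bell : (n k : ℕ) → (ℕ → ℚ) → ℚ
bell n k z = ℕ→ℚ (n NB.!) * foldr _+_ 0ℚ (map (termFrom 1 z) (admissible n k))

zSeq : ℕ → ℕ → ℚ
zSeq ℓ i with i ≟ suc ℓ
... | yes _ = 0ℚ
... | no _ = ℕ→ℚ (i NB.!)

-- binomial with integer top: 0 unless 0 ≤ j ≤ a
binomℤ : ℤ → ℕ → ℚ
binomℤ (+ a) j = ℕ→ℚ (a C j)
binomℤ ℤ.-[1+ _ ] j = 0ℚ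

sign : ℕ → ℚ
sign e = (- 1ℚ) ^ℚ e

δ : ℕ → ℕ → ℚ
δ a b with a ≟ b
... | yes _ = 1ℚ
... | no _ = 0ℚ

sumBelow : ℕ → (ℕ → ℚ) → ℚ
sumBelow k f = foldr _+_ 0ℚ (map f (upTo k))

rhs : (ℓ n k : ℕ) → ℚ
rhs ℓ n k =
  (ℕ→ℚ (n NB.!) * invFact k) *
  (sumBelow k (λ κ → sign κ * ℕ→ℚ (k C κ) *
      binomℤ ((+ n) ℤ.- (+ ((suc ℓ) NB.* κ)) ℤ.- (+ 1)) (k ∸ κ ∸ 1))
   + sign k * δ n (suc ℓ NB.* k))

-- Write w_i = z_i / i! for the normalised weights.  The proof has three parts.
-- (1) For an arbitrary sequence z, the sum over admissible multi-indices
--     defining B_{n,k}(z) is unfolded slot by slot (slotSum), and the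
--     "derivative in the number of blocks" identity  (K+1)·U_{K+1} = (Σ_j w_j x^j)·U_K
--     (slotSum-derivative) shows that K!·U_K is the coefficient of x^N in
--     (Σ_{i≥1} w_i x^i)^K (powCoeff).  Hence B_{n,k}(z) = n!/k! · [x^n](Σ w_i x^i)^k.
-- (2) For z = zSeq ℓ we have w_i = 1 − [i = L] with L = ℓ+1, so the coefficient
--     sequences satisfy  E_{K+1} = P E_K − S_L E_K,  where P is the strict
--     prefix-sum operator and S_L the shift by L.  As P and S_L commute, the
--     binomial theorem gives  E_K = Σ_κ (−1)^κ C(K,κ) S_{Lκ} P^{K−κ} δ₀
--     (inclExcl≡powCoeff, by induction on K via Pascal's rule).
-- (3) P^{j+1} δ₀ (M+1) = C(M,j) by the hockey-stick identity; this turns the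
--     expansion into the stated closed form, the term κ = k giving the
--     Kronecker delta.
module Submission where

open import Defs
open import Data.Nat using (ℕ; _≤_)
open import Relation.Binary.PropositionalEquality using (_≡_)

open import Data.Nat as N using (zero; suc; _∸_; z≤n; s≤s; _≟_; _≤?_)
import Data.Nat.Properties as NP
open import Data.Nat.Coprimality using (1-coprimeTo) renaming (sym to coprime-sym)
open import Data.Nat.Combinatorics
  using (_C_; nCn≡1; nCk+nC[k+1]≡[n+1]C[k+1]; k>n⇒nCk≡0)
import Data.Integer as ℤ
import Data.Integer.Properties as ZP
open import Data.Rational as Q using (ℚ; mkℚ; _+_; _*_; 0ℚ; 1ℚ)
open import Data.Rational.Base using (-_)
open import Data.Rational.Properties as QP using (normalize-coprime)
open import Data.Rational.Solver
open +-*-Solver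
open import Data.List using (List; []; _∷_; _++_; foldr; map; filter; concatMap; applyUpTo; upTo)
open import Data.Vec using (Vec; []; _∷_)
open import Data.Sum using (_⊎_; inj₁; inj₂)
open import Data.Empty using (⊥-elim)
open import Relation.Nullary using (Dec; yes; no; ¬_)
open import Relation.Nullary.Decidable using (_×-dec_)
open import Relation.Unary using (Pred; Decidable)
open import Relation.Binary.PropositionalEquality

ℕ→ℚ-mkℚ : ∀ n → ℕ→ℚ n ≡ mkℚ (ℤ.+ n) 0 (coprime-sym (1-coprimeTo n))
ℕ→ℚ-mkℚ n = normalize-coprime (coprime-sym (1-coprimeTo n))

ℕ→ℚ-+ : ∀ m n → ℕ→ℚ (m N.+ n) ≡ ℕ→ℚ m + ℕ→ℚ n
ℕ→ℚ-+ m n = sym (trans (cong₂ _+_ (ℕ→ℚ-mkℚ m) (ℕ→ℚ-mkℚ n))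
  (QP./-cong (cong₂ ℤ._+_ (ZP.*-identityʳ (ℤ.+ m)) (ZP.*-identityʳ (ℤ.+ n))) refl))

ℕ→ℚ-* : ∀ m n → ℕ→ℚ (m N.* n) ≡ ℕ→ℚ m * ℕ→ℚ n
ℕ→ℚ-* m n = sym (trans (cong₂ _*_ (ℕ→ℚ-mkℚ m) (ℕ→ℚ-mkℚ n)) (QP./-cong (sym (ZP.pos-* m n)) refl))

ℕ→ℚ-split : ∀ M a t → (¬ a N.≤ M → t ≡ 0ℚ) → ℕ→ℚ M * t ≡ ℕ→ℚ a * t + ℕ→ℚ (M ∸ a) * t
ℕ→ℚ-split M a t t≡0 with a ≤? M
... | yes a≤M = trans (cong (λ n → ℕ→ℚ n * t) (sym (NP.m+[n∸m]≡n a≤M)))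
                      (trans (cong (_* t) (ℕ→ℚ-+ a (M ∸ a))) (QP.*-distribʳ-+ t (ℕ→ℚ a) (ℕ→ℚ (M ∸ a))))
... | no a≰M rewrite t≡0 a≰M =
  solve 3 (λ x y u → x :* con 0ℚ := y :* con 0ℚ :+ u :* con 0ℚ) refl (ℕ→ℚ M) (ℕ→ℚ a) (ℕ→ℚ (M ∸ a))

recip-cancel : ∀ d .{{_ : N.NonZero d}} → (ℤ.+ 1 Q./ d) * ℕ→ℚ d ≡ 1ℚ
recip-cancel (suc d) =
  trans (cong₂ _*_ (normalize-coprime (1-coprimeTo (suc d))) (ℕ→ℚ-mkℚ (suc d)))
        (QP.*-inverseˡ (mkℚ (ℤ.+ suc d) 0 (coprime-sym (1-coprimeTo (suc d)))))

invFact-cancel : ∀ n → invFact n * ℕ→ℚ (n N.!) ≡ 1ℚ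
invFact-cancel n = recip-cancel (n N.!) {{n NP.!≢0}}

invFact-suc : ∀ n → ℕ→ℚ (suc n) * invFact (suc n) ≡ invFact n
invFact-suc n = begin
  s * i₁                     ≡⟨ sym (QP.*-identityˡ (s * i₁)) ⟩
  1ℚ * (s * i₁)              ≡⟨ cong (_* (s * i₁)) (sym (invFact-cancel n)) ⟩
  i₀ * f * (s * i₁)          ≡⟨ solve 4 (λ i₀ f s i₁ → i₀ :* f :* (s :* i₁) := i₀ :* (i₁ :* (s :* f))) refl i₀ f s i₁ ⟩
  i₀ * (i₁ * (s * f))        ≡⟨ cong (λ x → i₀ * (i₁ * x)) (sym (ℕ→ℚ-* (suc n) (n N.!))) ⟩
  i₀ * (i₁ * ℕ→ℚ (suc n N.!)) ≡⟨ cong (i₀ *_) (invFact-cancel (suc n)) ⟩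
  i₀ * 1ℚ                    ≡⟨ QP.*-identityʳ i₀ ⟩
  i₀                         ∎
  where
  open ≡-Reasoning
  s = ℕ→ℚ (suc n)
  i₁ = invFact (suc n)
  i₀ = invFact n
  f = ℕ→ℚ (n N.!)

χ : ∀ {p} {P : Set p} → Dec P → ℚ
χ (yes _) = 1ℚ
χ (no _) = 0ℚ

χ-yes : ∀ {p} {P : Set p} → P → (d : Dec P) → χ d ≡ 1ℚ
χ-yes x (yes _) = refl
χ-yes x (no ¬x) = ⊥-elim (¬x x)

χ-no : ∀ {p} {P : Set p} → ¬ P → (d : Dec P) → χ d ≡ 0ℚ
χ-no ¬x (yes x) = ⊥-elim (¬x x)
χ-no ¬x (no _) = refl

module _ {p q} {P : Set p} {Q : Set q} where
  χ-iff : (P → Q) → (Q → P) → (d : Dec P) (e : Dec Q) → χ d ≡ χ e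
  χ-iff f g (yes x) e = sym (χ-yes (f x) e)
  χ-iff f g (no ¬x) e = sym (χ-no (λ y → ¬x (g y)) e)

  χ-× : (d : Dec P) (e : Dec Q) → χ (d ×-dec e) ≡ χ d * χ e
  χ-× (yes x) (yes y) = refl
  χ-× (yes x) (no y) = refl
  χ-× (no x) (yes y) = refl
  χ-× (no x) (no y) = refl

χ-+≟ : ∀ a x K → χ (a N.+ x ≟ K) ≡ χ (a ≤? K) * χ (x ≟ K ∸ a)
χ-+≟ a x K with a ≤? K
... | yes a≤K = trans (χ-iff (λ e → trans (sym (NP.m+n∸m≡n a x)) (cong (_∸ a) e))
                              (λ e → trans (cong (a N.+_) e) (NP.m+[n∸m]≡n a≤K)) (a N.+ x ≟ K) (x ≟ K ∸ a))
                      (sym (QP.*-identityˡ _))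
... | no a≰K = trans (χ-no (λ e → a≰K (subst (a N.≤_) e (NP.m≤m+n a x))) (a N.+ x ≟ K))
                     (sym (QP.*-zeroˡ (χ (x ≟ K ∸ a))))

χ-+≤ : ∀ x y N → χ (x N.+ y ≤? N) ≡ χ (x ≤? N) * χ (y ≤? N ∸ x)
χ-+≤ x y N with x ≤? N
... | yes x≤N = trans (χ-iff (λ le → NP.m+n≤o⇒m≤o∸n y (subst (N._≤ N) (NP.+-comm x y) le))
                             (λ le → subst (x N.+ y N.≤_) (NP.m+[n∸m]≡n x≤N) (NP.+-monoʳ-≤ x le))
                             (x N.+ y ≤? N) (y ≤? N ∸ x))
                      (sym (QP.*-identityˡ _))
... | no x≰N = trans (χ-no (λ le → x≰N (NP.m+n≤o⇒m≤o x le)) (x N.+ y ≤? N)) (sym (QP.*-zeroˡ (χ (y ≤? N ∸ x))))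

χ-swap : ∀ x y N → χ (x ≤? N) * χ (y ≤? N ∸ x) ≡ χ (y ≤? N) * χ (x ≤? N ∸ y)
χ-swap x y N = trans (sym (χ-+≤ x y N)) (trans (cong (λ t → χ (t ≤? N)) (NP.+-comm x y)) (χ-+≤ y x N))

∸-swap : ∀ N x y → N ∸ x ∸ y ≡ N ∸ y ∸ x
∸-swap N x y = trans (NP.∸-+-assoc N x y) (trans (cong (N ∸_) (NP.+-comm x y)) (sym (NP.∸-+-assoc N y x)))

∑ : ℕ → (ℕ → ℚ) → ℚ
∑ zero f = 0ℚ
∑ (suc n) f = f 0 + ∑ n (λ i → f (suc i))

∑-cong : ∀ n {f g} → (∀ i → i N.< n → f i ≡ g i) → ∑ n f ≡ ∑ n g
∑-cong zero h = refl
∑-cong (suc n) h = cong₂ _+_ (h 0 (s≤s z≤n)) (∑-cong n (λ i i<n → h (suc i) (s≤s i<n)))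

∑-zero : ∀ n {f} → (∀ i → i N.< n → f i ≡ 0ℚ) → ∑ n f ≡ 0ℚ
∑-zero n h = trans (∑-cong n h) (∑-const0 n)
  where
  ∑-const0 : ∀ n → ∑ n (λ _ → 0ℚ) ≡ 0ℚ
  ∑-const0 zero = refl
  ∑-const0 (suc n) = trans (QP.+-identityˡ _) (∑-const0 n)

∑-last : ∀ n (f : ℕ → ℚ) → ∑ (suc n) f ≡ ∑ n f + f n
∑-last zero f = trans (QP.+-identityʳ (f 0)) (sym (QP.+-identityˡ (f 0)))
∑-last (suc n) f = trans (cong (f 0 +_) (∑-last n (λ i → f (suc i)))) (sym (QP.+-assoc (f 0) _ _))

∑-+ : ∀ n (f g : ℕ → ℚ) → ∑ n (λ i → f i + g i) ≡ ∑ n f + ∑ n g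
∑-+ zero f g = refl
∑-+ (suc n) f g = trans (cong ((f 0 + g 0) +_) (∑-+ n _ _))
  (solve 4 (λ a b c d → (a :+ b) :+ (c :+ d) := (a :+ c) :+ (b :+ d)) refl (f 0) (g 0) _ _)

∑-*ˡ : ∀ n c (f : ℕ → ℚ) → ∑ n (λ i → c * f i) ≡ c * ∑ n f
∑-*ˡ zero c f = sym (QP.*-zeroʳ c)
∑-*ˡ (suc n) c f = trans (cong (c * f 0 +_) (∑-*ˡ n c _)) (sym (QP.*-distribˡ-+ c (f 0) _))

∑-neg : ∀ n (f : ℕ → ℚ) → ∑ n (λ i → - f i) ≡ - ∑ n f
∑-neg n f = begin
  ∑ n (λ i → - f i)        ≡⟨ ∑-cong n (λ i _ → solve 1 (λ x → :- x := con (- 1ℚ) :* x) refl (f i)) ⟩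
  ∑ n (λ i → - 1ℚ * f i)   ≡⟨ ∑-*ˡ n (- 1ℚ) f ⟩
  - 1ℚ * ∑ n f             ≡⟨ solve 1 (λ x → con (- 1ℚ) :* x := :- x) refl (∑ n f) ⟩
  - ∑ n f                  ∎
  where open ≡-Reasoning

∑-swap : ∀ n m (f : ℕ → ℕ → ℚ) → ∑ n (λ i → ∑ m (f i)) ≡ ∑ m (λ j → ∑ n (λ i → f i j))
∑-swap zero m f = sym (∑-zero m (λ _ _ → refl))
∑-swap (suc n) m f = trans (cong (∑ m (f 0) +_) (∑-swap n m (λ i → f (suc i))))
  (sym (∑-+ m (f 0) (λ j → ∑ n (λ i → f (suc i) j))))

∑-split : ∀ n d (f : ℕ → ℚ) → ∑ (n N.+ d) f ≡ ∑ n f + ∑ d (λ j → f (n N.+ j))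
∑-split zero d f = sym (QP.+-identityˡ _)
∑-split (suc n) d f = trans (cong (f 0 +_) (∑-split n d (λ i → f (suc i)))) (sym (QP.+-assoc (f 0) _ _))

∑-reverse : ∀ n (f : ℕ → ℚ) → ∑ n (λ j → f (n ∸ suc j)) ≡ ∑ n f
∑-reverse zero f = refl
∑-reverse (suc n) f = trans (cong (f n +_) (∑-reverse n f)) (trans (QP.+-comm (f n) _) (sym (∑-last n f)))

∑-extend : ∀ n d (f : ℕ → ℚ) → (∀ j → j N.< d → f (n N.+ j) ≡ 0ℚ) → ∑ (n N.+ d) f ≡ ∑ n f
∑-extend n d f h = trans (∑-split n d f) (trans (cong (∑ n f +_) (∑-zero d h)) (QP.+-identityʳ _))

listSum : ∀ {A : Set} → (A → ℚ) → List A → ℚ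
listSum f xs = foldr _+_ 0ℚ (map f xs)

listSum-cong : ∀ {A : Set} {f g : A → ℚ} xs → (∀ x → f x ≡ g x) → listSum f xs ≡ listSum g xs
listSum-cong [] h = refl
listSum-cong (x ∷ xs) h = cong₂ _+_ (h x) (listSum-cong xs h)

listSum-*ˡ : ∀ {A : Set} c (f : A → ℚ) xs → listSum (λ x → c * f x) xs ≡ c * listSum f xs
listSum-*ˡ c f [] = sym (QP.*-zeroʳ c)
listSum-*ˡ c f (x ∷ xs) = trans (cong (c * f x +_) (listSum-*ˡ c f xs)) (sym (QP.*-distribˡ-+ c (f x) _))

listSum-filter : ∀ {A : Set} {p} {P : Pred A p} (P? : Decidable P) (t : A → ℚ) xs →
  listSum t (filter P? xs) ≡ listSum (λ x → χ (P? x) * t x) xs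
listSum-filter P? t [] = refl
listSum-filter P? t (x ∷ xs) with P? x
... | yes _ = cong₂ _+_ (sym (QP.*-identityˡ (t x))) (listSum-filter P? t xs)
... | no _ = trans (listSum-filter P? t xs) (trans (sym (QP.+-identityˡ _)) (cong (_+ _) (sym (QP.*-zeroˡ (t x)))))

listSum-++ : ∀ {A : Set} (f : A → ℚ) xs ys → listSum f (xs ++ ys) ≡ listSum f xs + listSum f ys
listSum-++ f [] ys = sym (QP.+-identityˡ _)
listSum-++ f (x ∷ xs) ys = trans (cong (f x +_) (listSum-++ f xs ys)) (sym (QP.+-assoc (f x) _ _))

listSum-map : ∀ {A B : Set} (f : B → ℚ) (g : A → B) xs → listSum f (map g xs) ≡ listSum (λ x → f (g x)) xs
listSum-map f g [] = refl
listSum-map f g (x ∷ xs) = cong (f (g x) +_) (listSum-map f g xs)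

listSum-concatMap : ∀ {A B : Set} (f : B → ℚ) (g : A → List B) xs →
  listSum f (concatMap g xs) ≡ listSum (λ x → listSum f (g x)) xs
listSum-concatMap f g [] = refl
listSum-concatMap f g (x ∷ xs) =
  trans (listSum-++ f (g x) (concatMap g xs)) (cong (listSum f (g x) +_) (listSum-concatMap f g xs))

listSum-applyUpTo : ∀ {A : Set} (f : A → ℚ) (g : ℕ → A) n → listSum f (applyUpTo g n) ≡ ∑ n (λ i → f (g i))
listSum-applyUpTo f g zero = refl
listSum-applyUpTo f g (suc n) = cong (f (g 0) +_) (listSum-applyUpTo f (λ i → g (suc i)) n)

listSum-upTo : ∀ (f : ℕ → ℚ) n → listSum f (upTo n) ≡ ∑ n f
listSum-upTo f n = listSum-applyUpTo f (λ i → i) n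

-- The slot-by-slot form of the Bell sum

weight : (ℕ → ℚ) → ℕ → ℚ
weight z s = z s * invFact s

-- Contribution of slot s filled with multiplicity a, when K blocks of total
-- size N remain to be placed:  [a ≤ K] [s·a ≤ N] w_s^a / a!.
slotCoeff : (ℕ → ℚ) → (s a K N : ℕ) → ℚ
slotCoeff z s a K N = χ (a ≤? K) * χ (s N.* a ≤? N) * (weight z s ^ℚ a * invFact a)

-- slotSum z s m b K N = Σ_α Π_i w_{s+i}^{α_i} / α_i!  over α ∈ {0,…,b}^m with
-- Σ α_i = K and Σ (s+i) α_i = N, summed over one slot at a time.
slotSum : (ℕ → ℚ) → (s m b K N : ℕ) → ℚ
slotSum z s zero b K N = χ (0 ≟ K) * χ (0 ≟ N)
slotSum z s (suc m) b K N =
  ∑ (suc b) (λ a → slotCoeff z s a K N * slotSum z (suc s) m b (K ∸ a) (N ∸ s N.* a))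

admissibleTerm : (ℕ → ℚ) → (s K N : ℕ) → ∀ {m} → Vec ℕ m → ℚ
admissibleTerm z s K N v = χ ((sumV v ≟ K) ×-dec (wsumFrom s v ≟ N)) * termFrom s z v

admissibleTerm-cons : ∀ z s K N a {m} (v : Vec ℕ m) →
  admissibleTerm z s K N (a ∷ v) ≡ slotCoeff z s a K N * admissibleTerm z (suc s) (K ∸ a) (N ∸ s N.* a) v
admissibleTerm-cons z s K N a v = begin
  χ ((a N.+ sumV v ≟ K) ×-dec (s N.* a N.+ wsumFrom (suc s) v ≟ N)) * (c * t)
    ≡⟨ cong (_* (c * t)) (χ-× (a N.+ sumV v ≟ K) (s N.* a N.+ wsumFrom (suc s) v ≟ N)) ⟩
  χ (a N.+ sumV v ≟ K) * χ (s N.* a N.+ wsumFrom (suc s) v ≟ N) * (c * t)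
    ≡⟨ cong₂ (λ x y → x * y * (c * t)) (χ-+≟ a (sumV v) K) (χ-+≟ (s N.* a) (wsumFrom (suc s) v) N) ⟩
  (p₁ * q₁) * (p₂ * q₂) * (c * t)
    ≡⟨ solve 6 (λ p₁ q₁ p₂ q₂ c t → (p₁ :* q₁) :* (p₂ :* q₂) :* (c :* t) := (p₁ :* p₂ :* c) :* ((q₁ :* q₂) :* t))
             refl p₁ q₁ p₂ q₂ c t ⟩
  (p₁ * p₂ * c) * ((q₁ * q₂) * t)
    ≡⟨ cong (λ x → (p₁ * p₂ * c) * (x * t)) (sym (χ-× (sumV v ≟ K ∸ a) (wsumFrom (suc s) v ≟ N ∸ s N.* a))) ⟩
  slotCoeff z s a K N * admissibleTerm z (suc s) (K ∸ a) (N ∸ s N.* a) v ∎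
  where
  open ≡-Reasoning
  c = weight z s ^ℚ a * invFact a
  t = termFrom (suc s) z v
  p₁ = χ (a ≤? K)
  q₁ = χ (sumV v ≟ K ∸ a)
  p₂ = χ (s N.* a ≤? N)
  q₂ = χ (wsumFrom (suc s) v ≟ N ∸ s N.* a)

listSum-admissible : ∀ z s m b K N → listSum (admissibleTerm z s K N) (boundedVecs m b) ≡ slotSum z s m b K N
listSum-admissible z s zero b K N = trans (QP.+-identityʳ _) (trans (QP.*-identityʳ _) (χ-× (0 ≟ K) (0 ≟ N)))
listSum-admissible z s (suc m) b K N = begin
  listSum t (concatMap (λ a → map (a ∷_) (boundedVecs m b)) (upTo (suc b)))
    ≡⟨ listSum-concatMap t (λ a → map (a ∷_) (boundedVecs m b)) (upTo (suc b)) ⟩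
  listSum (λ a → listSum t (map (a ∷_) (boundedVecs m b))) (upTo (suc b))
    ≡⟨ listSum-cong (upTo (suc b)) (λ a → listSum-map t (a ∷_) (boundedVecs m b)) ⟩
  listSum (λ a → listSum (λ v → t (a ∷ v)) (boundedVecs m b)) (upTo (suc b))
    ≡⟨ listSum-upTo (λ a → listSum (λ v → t (a ∷ v)) (boundedVecs m b)) (suc b) ⟩
  ∑ (suc b) (λ a → listSum (λ v → t (a ∷ v)) (boundedVecs m b))
    ≡⟨ ∑-cong (suc b) (λ a _ → firstSlot a) ⟩
  slotSum z s (suc m) b K N ∎
  where
  open ≡-Reasoning
  t = admissibleTerm z s K N
  firstSlot : ∀ a → listSum (λ v → t (a ∷ v)) (boundedVecs m b)
                  ≡ slotCoeff z s a K N * slotSum z (suc s) m b (K ∸ a) (N ∸ s N.* a)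
  firstSlot a = begin
    listSum (λ v → t (a ∷ v)) (boundedVecs m b)
      ≡⟨ listSum-cong (boundedVecs m b) (admissibleTerm-cons z s K N a) ⟩
    listSum (λ v → slotCoeff z s a K N * admissibleTerm z (suc s) (K ∸ a) (N ∸ s N.* a) v) (boundedVecs m b)
      ≡⟨ listSum-*ˡ (slotCoeff z s a K N) _ (boundedVecs m b) ⟩
    slotCoeff z s a K N * listSum (admissibleTerm z (suc s) (K ∸ a) (N ∸ s N.* a)) (boundedVecs m b)
      ≡⟨ cong (slotCoeff z s a K N *_) (listSum-admissible z (suc s) m b (K ∸ a) (N ∸ s N.* a)) ⟩
    slotCoeff z s a K N * slotSum z (suc s) m b (K ∸ a) (N ∸ s N.* a) ∎

bell≡slotSum : ∀ n k z → bell n k z ≡ ℕ→ℚ (n N.!) * slotSum z 1 (suc n ∸ k) n k n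
bell≡slotSum n k z = cong (ℕ→ℚ (n N.!) *_)
  (trans (listSum-filter (λ α → (sumV α ≟ k) ×-dec (wsumFrom 1 α ≟ n)) (termFrom 1 z) (boundedVecs (suc n ∸ k) n))
         (listSum-admissible z 1 (suc n ∸ k) n k n))

-- The derivative identity

-- Multiplication by Σ_j w_{s+j} x^{s+j}:
-- derivSum z s m b K N = Σ_{j<m} [s+j ≤ N] w_{s+j} · slotSum z s m b K (N − (s+j)).
derivSum : (ℕ → ℚ) → (s m b K N : ℕ) → ℚ
derivSum z s m b K N = ∑ m (λ j → χ (s N.+ j ≤? N) * (weight z (s N.+ j) * slotSum z s m b K (N ∸ (s N.+ j))))

slotCoeff-out : ∀ z s a K N → ¬ a N.≤ K → slotCoeff z s a K N ≡ 0ℚ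
slotCoeff-out z s a K N a≰K =
  trans (cong (λ t → t * χ (s N.* a ≤? N) * (weight z s ^ℚ a * invFact a)) (χ-no a≰K (a ≤? K)))
        (solve 2 (λ x y → con 0ℚ :* x :* y := con 0ℚ) refl (χ (s N.* a ≤? N)) (weight z s ^ℚ a * invFact a))

∸-*-suc : ∀ N s a → N ∸ s N.* suc a ≡ N ∸ s ∸ s N.* a
∸-*-suc N s a = trans (cong (N ∸_) (NP.*-suc s a)) (sym (NP.∸-+-assoc N s (s N.* a)))

-- Lowering the multiplicity of slot s by one:
-- (a+1) · c_{a+1}(K+1, N) = [s ≤ N] · w_s · c_a(K, N − s),  as (a+1)/(a+1)! = 1/a!.
slotCoeff-lower : ∀ z s a K N →
  ℕ→ℚ (suc a) * slotCoeff z s (suc a) (suc K) N ≡ χ (s ≤? N) * (weight z s * slotCoeff z s a K (N ∸ s))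
slotCoeff-lower z s a K N = begin
  sa * (χ (suc a ≤? suc K) * χ (s N.* suc a ≤? N) * (W * Wa * i₁))
    ≡⟨ cong₂ (λ x y → sa * (x * y * (W * Wa * i₁)))
             (χ-iff NP.≤-pred s≤s (suc a ≤? suc K) (a ≤? K))
             (trans (cong (λ t → χ (t ≤? N)) (NP.*-suc s a)) (χ-+≤ s (s N.* a) N)) ⟩
  sa * (p * (ps * q) * (W * Wa * i₁))
    ≡⟨ solve 7 (λ sa p ps q W Wa i₁ → sa :* (p :* (ps :* q) :* (W :* Wa :* i₁)) := ps :* (W :* (p :* q :* (Wa :* (sa :* i₁)))))
             refl sa p ps q W Wa i₁ ⟩
  ps * (W * (p * q * (Wa * (sa * i₁))))
    ≡⟨ cong (λ x → ps * (W * (p * q * (Wa * x)))) (invFact-suc a) ⟩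
  ps * (W * slotCoeff z s a K (N ∸ s)) ∎
  where
  open ≡-Reasoning
  sa = ℕ→ℚ (suc a)
  W = weight z s
  Wa = weight z s ^ℚ a
  i₁ = invFact (suc a)
  p = χ (a ≤? K)
  ps = χ (s ≤? N)
  q = χ (s N.* a ≤? N ∸ s)

slotCoeff-delay : ∀ z s a K N d →
  slotCoeff z s a K N * χ (d ≤? N ∸ s N.* a) ≡ χ (d ≤? N) * slotCoeff z s a K (N ∸ d)
slotCoeff-delay z s a K N d = begin
  pa * x₁ * c * y₁      ≡⟨ solve 4 (λ pa x₁ c y₁ → pa :* x₁ :* c :* y₁ := pa :* c :* (x₁ :* y₁)) refl pa x₁ c y₁ ⟩
  pa * c * (x₁ * y₁)    ≡⟨ cong (pa * c *_) (χ-swap (s N.* a) d N) ⟩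
  pa * c * (y₂ * x₂)    ≡⟨ solve 4 (λ pa c y₂ x₂ → pa :* c :* (y₂ :* x₂) := y₂ :* (pa :* x₂ :* c)) refl pa c y₂ x₂ ⟩
  y₂ * (pa * x₂ * c)    ∎
  where
  open ≡-Reasoning
  pa = χ (a ≤? K)
  c = weight z s ^ℚ a * invFact a
  x₁ = χ (s N.* a ≤? N)
  y₁ = χ (d ≤? N ∸ s N.* a)
  x₂ = χ (s N.* a ≤? N ∸ d)
  y₂ = χ (d ≤? N)

module _ (z : ℕ → ℚ) (s m b K N : ℕ) (K<b : K N.< b) where
  private
    V : ℕ → ℕ → ℚ
    V = slotSum z (suc s) m b
    term : ℕ → ℚ
    term a = slotCoeff z s a (suc K) N * V (suc K ∸ a) (N ∸ s N.* a)

  -- The blocks placed in slot s: the part a·c_a of (K+1)·c_a, summed over a,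
  -- is w_s times the slot sum with one block fewer.
  derivative-head : ∑ (suc b) (λ a → ℕ→ℚ a * term a) ≡ χ (s ≤? N) * (weight z s * slotSum z s (suc m) b K (N ∸ s))
  derivative-head = begin
    ℕ→ℚ 0 * term 0 + ∑ b (λ a → ℕ→ℚ (suc a) * term (suc a))
      ≡⟨ trans (cong (_+ ∑ b (λ a → ℕ→ℚ (suc a) * term (suc a))) (QP.*-zeroˡ (term 0))) (QP.+-identityˡ _) ⟩
    ∑ b (λ a → ℕ→ℚ (suc a) * term (suc a))
      ≡⟨ ∑-cong b (λ a _ → lower a) ⟩
    ∑ b (λ a → χ (s ≤? N) * (weight z s * h a))
      ≡⟨ trans (∑-*ˡ b (χ (s ≤? N)) (λ a → weight z s * h a)) (cong (χ (s ≤? N) *_) (∑-*ˡ b (weight z s) h)) ⟩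
    χ (s ≤? N) * (weight z s * ∑ b h)
      ≡⟨ cong (λ t → χ (s ≤? N) * (weight z s * t)) (sym (trans (∑-last b h) (trans (cong (∑ b h +_) hb≡0) (QP.+-identityʳ _)))) ⟩
    χ (s ≤? N) * (weight z s * ∑ (suc b) h) ∎
    where
    open ≡-Reasoning
    h : ℕ → ℚ
    h a = slotCoeff z s a K (N ∸ s) * V (K ∸ a) (N ∸ s ∸ s N.* a)
    hb≡0 : h b ≡ 0ℚ
    hb≡0 = trans (cong (_* V (K ∸ b) (N ∸ s ∸ s N.* b)) (slotCoeff-out z s b K (N ∸ s) (NP.<⇒≱ K<b)))
                 (QP.*-zeroˡ (V (K ∸ b) (N ∸ s ∸ s N.* b)))
    lower : ∀ a → ℕ→ℚ (suc a) * term (suc a) ≡ χ (s ≤? N) * (weight z s * h a)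
    lower a = begin
      ℕ→ℚ (suc a) * (slotCoeff z s (suc a) (suc K) N * V (K ∸ a) (N ∸ s N.* suc a))
        ≡⟨ sym (QP.*-assoc (ℕ→ℚ (suc a)) _ _) ⟩
      ℕ→ℚ (suc a) * slotCoeff z s (suc a) (suc K) N * V (K ∸ a) (N ∸ s N.* suc a)
        ≡⟨ cong₂ (λ x y → x * V (K ∸ a) y) (slotCoeff-lower z s a K N) (∸-*-suc N s a) ⟩
      χ (s ≤? N) * (weight z s * slotCoeff z s a K (N ∸ s)) * V (K ∸ a) (N ∸ s ∸ s N.* a)
        ≡⟨ solve 4 (λ p w c v → p :* (w :* c) :* v := p :* (w :* (c :* v))) refl (χ (s ≤? N)) (weight z s) _ _ ⟩
      χ (s ≤? N) * (weight z s * h a) ∎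

  -- The blocks placed in later slots: by the derivative identity for slot s+1
  -- (the hypothesis), the part (K+1−a)·c_a sums to the terms j ≥ 1 of derivSum.
  derivative-tail :
    (∀ K' N' → K' N.< b → ℕ→ℚ (suc K') * V (suc K') N' ≡ derivSum z (suc s) m b K' N') →
    ∑ (suc b) (λ a → ℕ→ℚ (suc K ∸ a) * term a)
      ≡ ∑ m (λ j → χ (s N.+ suc j ≤? N) * (weight z (s N.+ suc j) * slotSum z s (suc m) b K (N ∸ (s N.+ suc j))))
  derivative-tail IH = begin
    ∑ (suc b) (λ a → ℕ→ℚ (suc K ∸ a) * term a)
      ≡⟨ ∑-cong (suc b) (λ a _ → fewerBlocks a (a ≤? K)) ⟩
    ∑ (suc b) (λ a → slotCoeff z s a K N * derivSum z (suc s) m b (K ∸ a) (N ∸ s N.* a))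
      ≡⟨ ∑-cong (suc b) (λ a _ → sym (∑-*ˡ m (slotCoeff z s a K N) (F a))) ⟩
    ∑ (suc b) (λ a → ∑ m (λ j → slotCoeff z s a K N * F a j))
      ≡⟨ ∑-swap (suc b) m (λ a j → slotCoeff z s a K N * F a j) ⟩
    ∑ m (λ j → ∑ (suc b) (λ a → slotCoeff z s a K N * F a j))
      ≡⟨ ∑-cong m (λ j _ → collect j) ⟩
    ∑ m (λ j → χ (s N.+ suc j ≤? N) * (weight z (s N.+ suc j) * slotSum z s (suc m) b K (N ∸ (s N.+ suc j)))) ∎
    where
    open ≡-Reasoning
    F : ℕ → ℕ → ℚ
    F a j = χ (suc s N.+ j ≤? N ∸ s N.* a) * (weight z (suc s N.+ j) * V (K ∸ a) (N ∸ s N.* a ∸ (suc s N.+ j)))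

    fewerBlocks : ∀ a → Dec (a N.≤ K) →
      ℕ→ℚ (suc K ∸ a) * term a ≡ slotCoeff z s a K N * derivSum z (suc s) m b (K ∸ a) (N ∸ s N.* a)
    fewerBlocks a (yes a≤K) = begin
      ℕ→ℚ (suc K ∸ a) * (slotCoeff z s a (suc K) N * V (suc K ∸ a) (N ∸ s N.* a))
        ≡⟨ cong (λ t → ℕ→ℚ t * (slotCoeff z s a (suc K) N * V t (N ∸ s N.* a))) (NP.+-∸-assoc 1 a≤K) ⟩
      ℕ→ℚ (suc (K ∸ a)) * (slotCoeff z s a (suc K) N * V (suc (K ∸ a)) (N ∸ s N.* a))
        ≡⟨ solve 3 (λ x y v → x :* (y :* v) := y :* (x :* v)) refl
                 (ℕ→ℚ (suc (K ∸ a))) (slotCoeff z s a (suc K) N) (V (suc (K ∸ a)) (N ∸ s N.* a)) ⟩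
      slotCoeff z s a (suc K) N * (ℕ→ℚ (suc (K ∸ a)) * V (suc (K ∸ a)) (N ∸ s N.* a))
        ≡⟨ cong₂ _*_ sameCoeff (IH (K ∸ a) (N ∸ s N.* a) (NP.≤-<-trans (NP.m∸n≤m K a) K<b)) ⟩
      slotCoeff z s a K N * derivSum z (suc s) m b (K ∸ a) (N ∸ s N.* a) ∎
      where
      sameCoeff : slotCoeff z s a (suc K) N ≡ slotCoeff z s a K N
      sameCoeff = cong (λ t → t * χ (s N.* a ≤? N) * (weight z s ^ℚ a * invFact a))
                       (trans (χ-yes (NP.m≤n⇒m≤1+n a≤K) (a ≤? suc K)) (sym (χ-yes a≤K (a ≤? K))))
    fewerBlocks a (no a≰K) = begin
      ℕ→ℚ (suc K ∸ a) * term a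
        ≡⟨ cong (λ t → ℕ→ℚ t * term a) (NP.m≤n⇒m∸n≡0 (NP.≰⇒> a≰K)) ⟩
      0ℚ * term a
        ≡⟨ solve 2 (λ x y → con 0ℚ :* x := con 0ℚ :* y) refl (term a) (derivSum z (suc s) m b (K ∸ a) (N ∸ s N.* a)) ⟩
      0ℚ * derivSum z (suc s) m b (K ∸ a) (N ∸ s N.* a)
        ≡⟨ cong (_* derivSum z (suc s) m b (K ∸ a) (N ∸ s N.* a)) (sym (slotCoeff-out z s a K N a≰K)) ⟩
      slotCoeff z s a K N * derivSum z (suc s) m b (K ∸ a) (N ∸ s N.* a) ∎

    collect : ∀ j → ∑ (suc b) (λ a → slotCoeff z s a K N * F a j)
                    ≡ χ (s N.+ suc j ≤? N) * (weight z (s N.+ suc j) * slotSum z s (suc m) b K (N ∸ (s N.+ suc j)))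
    collect j = begin
      ∑ (suc b) (λ a → slotCoeff z s a K N * F a j)
        ≡⟨ ∑-cong (suc b) (λ a _ → delay a) ⟩
      ∑ (suc b) (λ a → χ (d ≤? N) * (weight z d * G a))
        ≡⟨ trans (∑-*ˡ (suc b) (χ (d ≤? N)) (λ a → weight z d * G a)) (cong (χ (d ≤? N) *_) (∑-*ˡ (suc b) (weight z d) G)) ⟩
      χ (d ≤? N) * (weight z d * slotSum z s (suc m) b K (N ∸ d))
        ≡⟨ cong (λ t → χ (t ≤? N) * (weight z t * slotSum z s (suc m) b K (N ∸ t))) (sym (NP.+-suc s j)) ⟩
      χ (s N.+ suc j ≤? N) * (weight z (s N.+ suc j) * slotSum z s (suc m) b K (N ∸ (s N.+ suc j))) ∎
      where
      d = suc s N.+ j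
      G : ℕ → ℚ
      G a = slotCoeff z s a K (N ∸ d) * V (K ∸ a) (N ∸ d ∸ s N.* a)
      delay : ∀ a → slotCoeff z s a K N * F a j ≡ χ (d ≤? N) * (weight z d * G a)
      delay a = begin
        c * (y * (weight z d * V (K ∸ a) (N ∸ s N.* a ∸ d)))
          ≡⟨ cong (λ t → c * (y * (weight z d * V (K ∸ a) t))) (∸-swap N (s N.* a) d) ⟩
        c * (y * (weight z d * v))
          ≡⟨ solve 4 (λ c y w v → c :* (y :* (w :* v)) := c :* y :* v :* w) refl c y (weight z d) v ⟩
        c * y * v * weight z d
          ≡⟨ cong (λ t → t * v * weight z d) (slotCoeff-delay z s a K N d) ⟩
        χ (d ≤? N) * slotCoeff z s a K (N ∸ d) * v * weight z d
          ≡⟨ solve 4 (λ x c v w → x :* c :* v :* w := x :* (w :* (c :* v))) refl (χ (d ≤? N)) _ v (weight z d) ⟩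
        χ (d ≤? N) * (weight z d * G a) ∎
        where
        c = slotCoeff z s a K N
        y = χ (d ≤? N ∸ s N.* a)
        v = V (K ∸ a) (N ∸ d ∸ s N.* a)

-- (K+1) · U_{K+1} = Σ_j w_{s+j} x^{s+j} · U_K, provided the multiplicity bound b
-- exceeds K: differentiate the truncated exponential Π_i Σ_{a≤b} (w_i x^i y)^a/a! in y.
slotSum-derivative : ∀ z s m b K N → K N.< b →
  ℕ→ℚ (suc K) * slotSum z s m b (suc K) N ≡ derivSum z s m b K N
slotSum-derivative z s zero b K N _ =
  trans (cong (λ t → ℕ→ℚ (suc K) * (t * χ (0 ≟ N))) (χ-no (λ ()) (0 ≟ suc K)))
        (solve 2 (λ x y → x :* (con 0ℚ :* y) := con 0ℚ) refl (ℕ→ℚ (suc K)) (χ (0 ≟ N)))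
slotSum-derivative z s (suc m) b K N K<b = begin
  ℕ→ℚ (suc K) * ∑ (suc b) term
    ≡⟨ sym (∑-*ˡ (suc b) (ℕ→ℚ (suc K)) term) ⟩
  ∑ (suc b) (λ a → ℕ→ℚ (suc K) * term a)
    ≡⟨ ∑-cong (suc b) (λ a _ → ℕ→ℚ-split (suc K) a (term a) (termOut a)) ⟩
  ∑ (suc b) (λ a → ℕ→ℚ a * term a + ℕ→ℚ (suc K ∸ a) * term a)
    ≡⟨ ∑-+ (suc b) (λ a → ℕ→ℚ a * term a) (λ a → ℕ→ℚ (suc K ∸ a) * term a) ⟩
  ∑ (suc b) (λ a → ℕ→ℚ a * term a) + ∑ (suc b) (λ a → ℕ→ℚ (suc K ∸ a) * term a)
    ≡⟨ cong₂ _+_ (trans (derivative-head z s m b K N K<b) headIndex)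
                 (derivative-tail z s m b K N K<b (λ K' N' → slotSum-derivative z (suc s) m b K' N')) ⟩
  derivSum z s (suc m) b K N ∎
  where
  open ≡-Reasoning
  term : ℕ → ℚ
  term a = slotCoeff z s a (suc K) N * slotSum z (suc s) m b (suc K ∸ a) (N ∸ s N.* a)
  termOut : ∀ a → ¬ a N.≤ suc K → term a ≡ 0ℚ
  termOut a a≰ = trans (cong (_* rest) (slotCoeff-out z s a (suc K) N a≰)) (QP.*-zeroˡ rest)
    where rest = slotSum z (suc s) m b (suc K ∸ a) (N ∸ s N.* a)
  headIndex : χ (s ≤? N) * (weight z s * slotSum z s (suc m) b K (N ∸ s))
            ≡ χ (s N.+ 0 ≤? N) * (weight z (s N.+ 0) * slotSum z s (suc m) b K (N ∸ (s N.+ 0)))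
  headIndex = cong (λ t → χ (t ≤? N) * (weight z t * slotSum z s (suc m) b K (N ∸ t))) (sym (NP.+-identityʳ s))

-- Coefficients of powers of the weight series

-- powCoeff z K N = [x^N] (Σ_{i≥1} w_i x^i)^K
powCoeff : (ℕ → ℚ) → ℕ → ℕ → ℚ
powCoeff z zero N = χ (0 ≟ N)
powCoeff z (suc K) N = ∑ N (λ j → weight z (suc j) * powCoeff z K (N ∸ suc j))

∸-suc< : ∀ {j N} → suc j N.≤ N → N ∸ suc j N.< N
∸-suc< {j} {N} le = NP.∸-monoʳ-< {m = N} {n = suc j} {o = 0} (s≤s z≤n) le

powCoeff-below : ∀ z K t → t N.< K → powCoeff z K t ≡ 0ℚ
powCoeff-below z (suc K) t (s≤s t≤K) = ∑-zero t (λ j j<t →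
  trans (cong (weight z (suc j) *_) (powCoeff-below z K (t ∸ suc j) (NP.<-≤-trans (∸-suc< j<t) t≤K)))
        (QP.*-zeroʳ (weight z (suc j))))

slotSum-noBlocks : ∀ z s m b N → slotSum z s m b 0 N ≡ χ (0 ≟ N)
slotSum-noBlocks z s zero b N = QP.*-identityˡ _
slotSum-noBlocks z s (suc m) b N = begin
  slotCoeff z s 0 0 N * U 0 (N ∸ s N.* 0) + ∑ b (λ a → slotCoeff z s (suc a) 0 N * U 0 (N ∸ s N.* suc a))
    ≡⟨ cong₂ _+_ (cong₂ _*_ emptySlot (trans (slotSum-noBlocks z (suc s) m b (N ∸ s N.* 0))
                                              (cong (λ t → χ (0 ≟ N ∸ t)) (NP.*-zeroʳ s))))
                 (∑-zero b (λ a _ → trans (cong (_* U 0 (N ∸ s N.* suc a)) (slotCoeff-out z s (suc a) 0 N (λ ())))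
                                          (QP.*-zeroˡ (U 0 (N ∸ s N.* suc a))))) ⟩
  1ℚ * χ (0 ≟ N) + 0ℚ
    ≡⟨ trans (QP.+-identityʳ _) (QP.*-identityˡ _) ⟩
  χ (0 ≟ N) ∎
  where
  open ≡-Reasoning
  U = slotSum z (suc s) m b
  emptySlot : slotCoeff z s 0 0 N ≡ 1ℚ
  emptySlot = cong (λ t → 1ℚ * t * (1ℚ * 1ℚ)) (χ-yes (subst (N._≤ N) (sym (NP.*-zeroʳ s)) z≤n) (s N.* 0 ≤? N))

-- If P agrees with the K-th coefficients below N, then multiplying P by the
-- weight series (derivSum at s = 1, truncated to m terms) gives the (K+1)-th
-- coefficient at N, provided N ≤ m + K so that the truncation loses nothing.
powCoeff-step : ∀ z m N K (P : ℕ → ℚ) → N N.≤ m N.+ K →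
  (∀ t → t N.< N → P t ≡ powCoeff z K t) →
  ∑ m (λ j → χ (suc j ≤? N) * (weight z (suc j) * P (N ∸ suc j))) ≡ powCoeff z (suc K) N
powCoeff-step z m N K P N≤m+K agree = compare (NP.≤-total m N)
  where
  open ≡-Reasoning
  g f : ℕ → ℚ
  g j = χ (suc j ≤? N) * (weight z (suc j) * P (N ∸ suc j))
  f j = weight z (suc j) * powCoeff z K (N ∸ suc j)

  g≡f : ∀ j → j N.< N → g j ≡ f j
  g≡f j j<N = trans (cong₂ (λ x y → x * (weight z (suc j) * y)) (χ-yes j<N (suc j ≤? N)) (agree (N ∸ suc j) (∸-suc< j<N)))
                    (QP.*-identityˡ _)

  -- beyond index m of f, the remaining degree N − (m+j+1) is below K
  fTail : ∀ j → j N.< N ∸ m → f (m N.+ j) ≡ 0ℚ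
  fTail j j<N∸m = trans (cong (weight z (suc (m N.+ j)) *_) (powCoeff-below z K (N ∸ suc (m N.+ j)) low))
                        (QP.*-zeroʳ (weight z (suc (m N.+ j))))
    where
    m<N : m N.< N
    m<N = NP.m∸n≢0⇒n<m (λ e → NP.n≮0 (subst (j N.<_) e j<N∸m))
    low : N ∸ suc (m N.+ j) N.< K
    -- N − (m+j+1) ≤ N − (m+1) < N − m ≤ K
    low = NP.<-≤-trans (NP.≤-<-trans (NP.∸-monoʳ-≤ N (s≤s (NP.m≤m+n m j))) (NP.∸-monoʳ-< (NP.n<1+n m) m<N))
                       (NP.m≤n+o⇒m∸n≤o N m N≤m+K)

  gTail : ∀ j → g (N N.+ j) ≡ 0ℚ
  gTail j = trans (cong (_* (weight z (suc (N N.+ j)) * P (N ∸ suc (N N.+ j))))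
                        (χ-no (λ le → NP.<⇒≱ le (NP.m≤m+n N j)) (suc (N N.+ j) ≤? N)))
                  (QP.*-zeroˡ (weight z (suc (N N.+ j)) * P (N ∸ suc (N N.+ j))))

  compare : m N.≤ N ⊎ N N.≤ m → ∑ m g ≡ ∑ N f
  compare (inj₁ m≤N) = begin
    ∑ m g                   ≡⟨ ∑-cong m (λ j j<m → g≡f j (NP.<-≤-trans j<m m≤N)) ⟩
    ∑ m f                   ≡⟨ sym (∑-extend m (N ∸ m) f fTail) ⟩
    ∑ (m N.+ (N ∸ m)) f     ≡⟨ cong (λ t → ∑ t f) (NP.m+[n∸m]≡n m≤N) ⟩
    ∑ N f                   ∎
  compare (inj₂ N≤m) = begin
    ∑ m g                   ≡⟨ cong (λ t → ∑ t g) (sym (NP.m+[n∸m]≡n N≤m)) ⟩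
    ∑ (N N.+ (m ∸ N)) g     ≡⟨ ∑-extend N (m ∸ N) g (λ j _ → gTail j) ⟩
    ∑ N g                   ≡⟨ ∑-cong N g≡f ⟩
    ∑ N f                   ∎

-- K! · U_K(N) = [x^N] (Σ_{i≥1} w_i x^i)^K, as long as the multiplicity bound b
-- is at least K and the m slots 1, …, m reach every part size that can occur.
slotSum≡powCoeff : ∀ z m b K N → K N.≤ b → N N.< m N.+ K → ℕ→ℚ (K N.!) * slotSum z 1 m b K N ≡ powCoeff z K N
slotSum≡powCoeff z m b zero N _ _ = trans (QP.*-identityˡ _) (slotSum-noBlocks z 1 m b N)
slotSum≡powCoeff z m b (suc K) N K<b N< = begin
  ℕ→ℚ (suc K N.* K N.!) * U (suc K) N
    ≡⟨ cong (_* U (suc K) N) (ℕ→ℚ-* (suc K) (K N.!)) ⟩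
  ℕ→ℚ (suc K) * k! * U (suc K) N
    ≡⟨ solve 3 (λ a b c → a :* b :* c := b :* (a :* c)) refl (ℕ→ℚ (suc K)) k! (U (suc K) N) ⟩
  k! * (ℕ→ℚ (suc K) * U (suc K) N)
    ≡⟨ cong (k! *_) (slotSum-derivative z 1 m b K N K<b) ⟩
  k! * ∑ m (λ j → χ (suc j ≤? N) * (weight z (suc j) * U K (N ∸ suc j)))
    ≡⟨ sym (∑-*ˡ m k! (λ j → χ (suc j ≤? N) * (weight z (suc j) * U K (N ∸ suc j)))) ⟩
  ∑ m (λ j → k! * (χ (suc j ≤? N) * (weight z (suc j) * U K (N ∸ suc j))))
    ≡⟨ ∑-cong m (λ j _ → solve 4 (λ f x y u → f :* (x :* (y :* u)) := x :* (y :* (f :* u))) refl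
                               k! (χ (suc j ≤? N)) (weight z (suc j)) (U K (N ∸ suc j))) ⟩
  ∑ m (λ j → χ (suc j ≤? N) * (weight z (suc j) * (k! * U K (N ∸ suc j))))
    ≡⟨ powCoeff-step z m N K (λ t → k! * U K t) N≤m+K
         (λ t t<N → slotSum≡powCoeff z m b K t (NP.<⇒≤ K<b) (NP.<-≤-trans t<N N≤m+K)) ⟩
  powCoeff z (suc K) N ∎
  where
  open ≡-Reasoning
  U = slotSum z 1 m b
  k! = ℕ→ℚ (K N.!)
  N≤m+K : N N.≤ m N.+ K
  N≤m+K = NP.≤-pred (subst (N N.<_) (NP.+-suc m K) N<)
-- The specialisation z = zSeq ℓ

weight-zSeq : ∀ ℓ i → weight (zSeq ℓ) i ≡ 1ℚ + - χ (i ≟ suc ℓ)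
weight-zSeq ℓ i with i ≟ suc ℓ
... | yes _ = QP.*-zeroˡ (invFact i)
... | no _ = trans (QP.*-comm (ℕ→ℚ (i N.!)) (invFact i)) (invFact-cancel i)

∑-χ≟ : ∀ N ℓ (f : ℕ → ℚ) → ∑ N (λ j → χ (j ≟ ℓ) * f j) ≡ χ (suc ℓ ≤? N) * f ℓ
∑-χ≟ zero ℓ f = sym (trans (cong (_* f ℓ) (χ-no (λ ()) (suc ℓ ≤? 0))) (QP.*-zeroˡ (f ℓ)))
∑-χ≟ (suc N) zero f = begin
  1ℚ * f 0 + ∑ N (λ j → χ (suc j ≟ 0) * f (suc j))
    ≡⟨ cong (1ℚ * f 0 +_) (∑-zero N (λ j _ → trans (cong (_* f (suc j)) (χ-no (λ ()) (suc j ≟ 0))) (QP.*-zeroˡ (f (suc j))))) ⟩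
  1ℚ * f 0 + 0ℚ
    ≡⟨ QP.+-identityʳ (1ℚ * f 0) ⟩
  χ (1 ≤? suc N) * f 0 ∎
  where open ≡-Reasoning
∑-χ≟ (suc N) (suc ℓ) f = begin
  0ℚ * f 0 + ∑ N (λ j → χ (suc j ≟ suc ℓ) * f (suc j))
    ≡⟨ trans (cong (_+ ∑ N (λ j → χ (suc j ≟ suc ℓ) * f (suc j))) (QP.*-zeroˡ (f 0))) (QP.+-identityˡ _) ⟩
  ∑ N (λ j → χ (suc j ≟ suc ℓ) * f (suc j))
    ≡⟨ ∑-cong N (λ j _ → cong (_* f (suc j)) (χ-iff (cong N.pred) (cong suc) (suc j ≟ suc ℓ) (j ≟ ℓ))) ⟩
  ∑ N (λ j → χ (j ≟ ℓ) * f (suc j))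
    ≡⟨ ∑-χ≟ N ℓ (λ j → f (suc j)) ⟩
  χ (suc ℓ ≤? N) * f (suc ℓ)
    ≡⟨ cong (_* f (suc ℓ)) (χ-iff s≤s NP.≤-pred (suc ℓ ≤? N) (suc (suc ℓ) ≤? suc N)) ⟩
  χ (suc (suc ℓ) ≤? suc N) * f (suc ℓ) ∎
  where open ≡-Reasoning

shift : ℕ → (ℕ → ℚ) → ℕ → ℚ
shift d f N = χ (d ≤? N) * f (N ∸ d)

powCoeff-zSeq : ∀ ℓ K N →
  powCoeff (zSeq ℓ) (suc K) N ≡ ∑ N (powCoeff (zSeq ℓ) K) + - shift (suc ℓ) (powCoeff (zSeq ℓ) K) N
powCoeff-zSeq ℓ K N = begin
  ∑ N (λ j → weight (zSeq ℓ) (suc j) * e j)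
    ≡⟨ ∑-cong N (λ j _ → trans (cong (_* e j) (weight-zSeq′ j))
           (solve 2 (λ x y → (con 1ℚ :+ (:- x)) :* y := y :+ (:- (x :* y))) refl (χ (j ≟ ℓ)) (e j))) ⟩
  ∑ N (λ j → e j + - (χ (j ≟ ℓ) * e j))
    ≡⟨ ∑-+ N e (λ j → - (χ (j ≟ ℓ) * e j)) ⟩
  ∑ N e + ∑ N (λ j → - (χ (j ≟ ℓ) * e j))
    ≡⟨ cong₂ _+_ (∑-reverse N (powCoeff (zSeq ℓ) K)) (trans (∑-neg N (λ j → χ (j ≟ ℓ) * e j)) (cong -_ (∑-χ≟ N ℓ e))) ⟩
  ∑ N (powCoeff (zSeq ℓ) K) + - shift (suc ℓ) (powCoeff (zSeq ℓ) K) N ∎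
  where
  open ≡-Reasoning
  e : ℕ → ℚ
  e j = powCoeff (zSeq ℓ) K (N ∸ suc j)
  weight-zSeq′ : ∀ j → weight (zSeq ℓ) (suc j) ≡ 1ℚ + - χ (j ≟ ℓ)
  weight-zSeq′ j = trans (weight-zSeq ℓ (suc j)) (cong (λ t → 1ℚ + - t) (χ-iff (cong N.pred) (cong suc) (suc j ≟ suc ℓ) (j ≟ ℓ)))

-- Inclusion–exclusion: the solution of that recurrence

prefixIter : ℕ → ℕ → ℚ
prefixIter zero N = χ (0 ≟ N)
prefixIter (suc j) N = ∑ N (prefixIter j)

-- inclExcl L K = (P − S_L)^K δ₀ = Σ_{κ≤K} (−1)^κ C(K,κ) S_{Lκ} P^{K−κ} δ₀
inclExcl : ℕ → ℕ → ℕ → ℚ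
inclExcl L K N = ∑ (suc K) (λ κ → sign κ * ℕ→ℚ (K C κ) * shift (L N.* κ) (prefixIter (K ∸ κ)) N)

-- P and S_d commute:  Σ_{t<N} (S_d f)(t) = [d ≤ N] Σ_{t<N−d} f t
∑-shift : ∀ d (f : ℕ → ℚ) N → ∑ N (shift d f) ≡ shift d (λ M → ∑ M f) N
∑-shift d f N with d ≤? N
... | yes d≤N = begin
  ∑ N (shift d f)
    ≡⟨ cong (λ t → ∑ t (shift d f)) (sym (NP.m+[n∸m]≡n d≤N)) ⟩
  ∑ (d N.+ (N ∸ d)) (shift d f)
    ≡⟨ ∑-split d (N ∸ d) (shift d f) ⟩
  ∑ d (shift d f) + ∑ (N ∸ d) (λ j → shift d f (d N.+ j))
    ≡⟨ cong₂ _+_ (∑-zero d (λ i i<d → trans (cong (_* f (i ∸ d)) (χ-no (NP.<⇒≱ i<d) (d ≤? i))) (QP.*-zeroˡ (f (i ∸ d)))))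
                 (∑-cong (N ∸ d) (λ j _ → trans (cong₂ _*_ (χ-yes (NP.m≤m+n d j) (d ≤? d N.+ j)) (cong f (NP.m+n∸m≡n d j)))
                                                (QP.*-identityˡ (f j)))) ⟩
  0ℚ + ∑ (N ∸ d) f
    ≡⟨ trans (QP.+-identityˡ (∑ (N ∸ d) f)) (sym (QP.*-identityˡ (∑ (N ∸ d) f))) ⟩
  1ℚ * ∑ (N ∸ d) f ∎
  where open ≡-Reasoning
... | no d≰N = trans (∑-zero N (λ i i<N → trans (cong (_* f (i ∸ d)) (χ-no (λ le → d≰N (NP.≤-trans le (NP.<⇒≤ i<N))) (d ≤? i)))
                                                (QP.*-zeroˡ (f (i ∸ d)))))
                     (sym (QP.*-zeroˡ (∑ (N ∸ d) f)))

shift-shift : ∀ L d (f : ℕ → ℚ) N → shift L (shift d f) N ≡ shift (L N.+ d) f N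
shift-shift L d f N = trans (sym (QP.*-assoc (χ (L ≤? N)) (χ (d ≤? N ∸ L)) (f (N ∸ L ∸ d))))
  (cong₂ _*_ (sym (χ-+≤ L d N)) (cong f (NP.∸-+-assoc N L d)))

inclExcl-prefix : ∀ L K N →
  ∑ N (inclExcl L K) ≡ ∑ (suc K) (λ κ → sign κ * ℕ→ℚ (K C κ) * shift (L N.* κ) (prefixIter (suc K ∸ κ)) N)
inclExcl-prefix L K N = begin
  ∑ N (λ t → ∑ (suc K) (λ κ → c κ * y κ t))
    ≡⟨ ∑-swap N (suc K) (λ t κ → c κ * y κ t) ⟩
  ∑ (suc K) (λ κ → ∑ N (λ t → c κ * y κ t))
    ≡⟨ ∑-cong (suc K) (λ κ κ≤K → trans (∑-*ˡ N (c κ) (λ t → y κ t)) (cong (c κ *_) (raise κ (NP.≤-pred κ≤K)))) ⟩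
  ∑ (suc K) (λ κ → c κ * shift (L N.* κ) (prefixIter (suc K ∸ κ)) N) ∎
  where
  open ≡-Reasoning
  c : ℕ → ℚ
  c κ = sign κ * ℕ→ℚ (K C κ)
  y : ℕ → ℕ → ℚ
  y κ = shift (L N.* κ) (prefixIter (K ∸ κ))
  raise : ∀ κ → κ N.≤ K → ∑ N (y κ) ≡ shift (L N.* κ) (prefixIter (suc K ∸ κ)) N
  raise κ κ≤K = trans (∑-shift (L N.* κ) (prefixIter (K ∸ κ)) N)
                      (cong (λ t → shift (L N.* κ) (prefixIter t) N) (sym (NP.+-∸-assoc 1 κ≤K)))

inclExcl-shift : ∀ L K N →
  - shift L (inclExcl L K) N ≡ ∑ (suc K) (λ κ → sign (suc κ) * ℕ→ℚ (K C κ) * shift (L N.* suc κ) (prefixIter (K ∸ κ)) N)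
inclExcl-shift L K N = begin
  - (χ (L ≤? N) * ∑ (suc K) (λ κ → c κ * y κ (N ∸ L)))
    ≡⟨ cong -_ (sym (∑-*ˡ (suc K) (χ (L ≤? N)) (λ κ → c κ * y κ (N ∸ L)))) ⟩
  - ∑ (suc K) (λ κ → χ (L ≤? N) * (c κ * y κ (N ∸ L)))
    ≡⟨ sym (∑-neg (suc K) (λ κ → χ (L ≤? N) * (c κ * y κ (N ∸ L)))) ⟩
  ∑ (suc K) (λ κ → - (χ (L ≤? N) * (c κ * y κ (N ∸ L))))
    ≡⟨ ∑-cong (suc K) (λ κ _ → raise κ) ⟩
  ∑ (suc K) (λ κ → sign (suc κ) * ℕ→ℚ (K C κ) * shift (L N.* suc κ) (prefixIter (K ∸ κ)) N) ∎
  where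
  open ≡-Reasoning
  c : ℕ → ℚ
  c κ = sign κ * ℕ→ℚ (K C κ)
  y : ℕ → ℕ → ℚ
  y κ = shift (L N.* κ) (prefixIter (K ∸ κ))
  raise : ∀ κ → - (χ (L ≤? N) * (c κ * y κ (N ∸ L)))
                ≡ sign (suc κ) * ℕ→ℚ (K C κ) * shift (L N.* suc κ) (prefixIter (K ∸ κ)) N
  raise κ = begin
    - (χ (L ≤? N) * (sign κ * ℕ→ℚ (K C κ) * y κ (N ∸ L)))
      ≡⟨ solve 4 (λ x s b v → :- (x :* (s :* b :* v)) := (con (- 1ℚ) :* s) :* b :* (x :* v)) refl
                 (χ (L ≤? N)) (sign κ) (ℕ→ℚ (K C κ)) (y κ (N ∸ L)) ⟩
    sign (suc κ) * ℕ→ℚ (K C κ) * shift L (y κ) N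
      ≡⟨ cong (sign (suc κ) * ℕ→ℚ (K C κ) *_) (shift-shift L (L N.* κ) (prefixIter (K ∸ κ)) N) ⟩
    sign (suc κ) * ℕ→ℚ (K C κ) * shift (L N.+ L N.* κ) (prefixIter (K ∸ κ)) N
      ≡⟨ cong (λ t → sign (suc κ) * ℕ→ℚ (K C κ) * shift t (prefixIter (K ∸ κ)) N) (sym (NP.*-suc L κ)) ⟩
    sign (suc κ) * ℕ→ℚ (K C κ) * shift (L N.* suc κ) (prefixIter (K ∸ κ)) N ∎

-- Pascal's rule in the form C(K+1, κ) = C(K, κ) + C(K, κ−1), with C(K, −1) = 0
binomBelow : ℕ → ℕ → ℕ
binomBelow K zero = 0
binomBelow K (suc κ) = K C κ

pascal : ∀ K κ → suc K C κ ≡ K C κ N.+ binomBelow K κ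
pascal K zero = refl
pascal K (suc κ) = trans (sym (nCk+nC[k+1]≡[n+1]C[k+1] K κ)) (NP.+-comm (K C κ) (K C suc κ))

inclExcl-step : ∀ L K N → inclExcl L (suc K) N ≡ ∑ N (inclExcl L K) + - shift L (inclExcl L K) N
inclExcl-step L K N = begin
  ∑ (suc (suc K)) (λ κ → sign κ * ℕ→ℚ (suc K C κ) * y κ)
    ≡⟨ ∑-cong (suc (suc K)) (λ κ _ → splitPascal κ) ⟩
  ∑ (suc (suc K)) (λ κ → a₁ κ + a₂ κ)
    ≡⟨ ∑-+ (suc (suc K)) a₁ a₂ ⟩
  ∑ (suc (suc K)) a₁ + (a₂ 0 + ∑ (suc K) (λ κ → a₂ (suc κ)))
    ≡⟨ cong₂ _+_ (trans (∑-last (suc K) a₁) (trans (cong (∑ (suc K) a₁ +_) a₁-top) (QP.+-identityʳ (∑ (suc K) a₁))))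
                 (trans (cong (_+ ∑ (suc K) (λ κ → a₂ (suc κ))) a₂-bottom) (QP.+-identityˡ _)) ⟩
  ∑ (suc K) a₁ + ∑ (suc K) (λ κ → a₂ (suc κ))
    ≡⟨ cong₂ _+_ (sym (inclExcl-prefix L K N)) (sym (inclExcl-shift L K N)) ⟩
  ∑ N (inclExcl L K) + - shift L (inclExcl L K) N ∎
  where
  open ≡-Reasoning
  y : ℕ → ℚ
  y κ = shift (L N.* κ) (prefixIter (suc K ∸ κ)) N
  a₁ a₂ : ℕ → ℚ
  a₁ κ = sign κ * ℕ→ℚ (K C κ) * y κ
  a₂ κ = sign κ * ℕ→ℚ (binomBelow K κ) * y κ
  splitPascal : ∀ κ → sign κ * ℕ→ℚ (suc K C κ) * y κ ≡ a₁ κ + a₂ κ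
  splitPascal κ = trans (cong (λ t → sign κ * t * y κ) (trans (cong ℕ→ℚ (pascal K κ)) (ℕ→ℚ-+ (K C κ) (binomBelow K κ))))
    (solve 4 (λ s b₁ b₂ v → s :* (b₁ :+ b₂) :* v := s :* b₁ :* v :+ s :* b₂ :* v) refl
           (sign κ) (ℕ→ℚ (K C κ)) (ℕ→ℚ (binomBelow K κ)) (y κ))
  a₁-top : a₁ (suc K) ≡ 0ℚ
  a₁-top = trans (cong (λ t → sign (suc K) * ℕ→ℚ t * y (suc K)) (k>n⇒nCk≡0 (NP.n<1+n K)))
    (solve 2 (λ s v → s :* con 0ℚ :* v := con 0ℚ) refl (sign (suc K)) (y (suc K)))
  a₂-bottom : a₂ 0 ≡ 0ℚ
  a₂-bottom = solve 1 (λ v → con 1ℚ :* con 0ℚ :* v := con 0ℚ) refl (y 0)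

-- Both sides satisfy the same recurrence in K, hence agree.
inclExcl≡powCoeff : ∀ ℓ K N → inclExcl (suc ℓ) K N ≡ powCoeff (zSeq ℓ) K N
inclExcl≡powCoeff ℓ zero N = begin
  1ℚ * 1ℚ * shift (suc ℓ N.* 0) (prefixIter 0) N + 0ℚ
    ≡⟨ cong (λ d → 1ℚ * 1ℚ * shift d (prefixIter 0) N + 0ℚ) (NP.*-zeroʳ (suc ℓ)) ⟩
  1ℚ * 1ℚ * (χ (0 ≤? N) * χ (0 ≟ N)) + 0ℚ
    ≡⟨ cong (λ t → 1ℚ * 1ℚ * (t * χ (0 ≟ N)) + 0ℚ) (χ-yes z≤n (0 ≤? N)) ⟩
  1ℚ * 1ℚ * (1ℚ * χ (0 ≟ N)) + 0ℚ
    ≡⟨ solve 1 (λ x → con 1ℚ :* con 1ℚ :* (con 1ℚ :* x) :+ con 0ℚ := x) refl (χ (0 ≟ N)) ⟩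
  χ (0 ≟ N) ∎
  where open ≡-Reasoning
inclExcl≡powCoeff ℓ (suc K) N = begin
  inclExcl L (suc K) N
    ≡⟨ inclExcl-step L K N ⟩
  ∑ N (inclExcl L K) + - shift L (inclExcl L K) N
    ≡⟨ cong₂ (λ x y → x + - y) (∑-cong N (λ t _ → inclExcl≡powCoeff ℓ K t))
                              (cong (χ (L ≤? N) *_) (inclExcl≡powCoeff ℓ K (N ∸ L))) ⟩
  ∑ N (powCoeff (zSeq ℓ) K) + - shift L (powCoeff (zSeq ℓ) K) N
    ≡⟨ sym (powCoeff-zSeq ℓ K N) ⟩
  powCoeff (zSeq ℓ) (suc K) N ∎
  where
  open ≡-Reasoning
  L = suc ℓ
-- Closed forms

hockeyStick : ∀ j M → ∑ M (λ t → ℕ→ℚ (t C j)) ≡ ℕ→ℚ (M C suc j)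
hockeyStick j zero = cong ℕ→ℚ (sym (k>n⇒nCk≡0 {0} {suc j} (s≤s z≤n)))
hockeyStick j (suc M) = begin
  ∑ (suc M) (λ t → ℕ→ℚ (t C j))            ≡⟨ ∑-last M (λ t → ℕ→ℚ (t C j)) ⟩
  ∑ M (λ t → ℕ→ℚ (t C j)) + ℕ→ℚ (M C j)    ≡⟨ cong (_+ ℕ→ℚ (M C j)) (hockeyStick j M) ⟩
  ℕ→ℚ (M C suc j) + ℕ→ℚ (M C j)            ≡⟨ sym (ℕ→ℚ-+ (M C suc j) (M C j)) ⟩
  ℕ→ℚ (M C suc j N.+ M C j)                ≡⟨ cong ℕ→ℚ (NP.+-comm (M C suc j) (M C j)) ⟩
  ℕ→ℚ (M C j N.+ M C suc j)                ≡⟨ cong ℕ→ℚ (nCk+nC[k+1]≡[n+1]C[k+1] M j) ⟩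
  ℕ→ℚ (suc M C suc j)                      ∎
  where open ≡-Reasoning

prefixIter-binom : ∀ j M → prefixIter (suc j) (suc M) ≡ ℕ→ℚ (M C j)
prefixIter-binom zero M = begin
  1ℚ + ∑ M (λ t → χ (0 ≟ suc t))   ≡⟨ cong (1ℚ +_) (∑-zero M (λ t _ → χ-no (λ ()) (0 ≟ suc t))) ⟩
  1ℚ + 0ℚ                          ≡⟨ QP.+-identityʳ 1ℚ ⟩
  1ℚ                               ∎
  where open ≡-Reasoning
prefixIter-binom (suc j) M = begin
  0ℚ + ∑ M (λ t → prefixIter (suc j) (suc t))   ≡⟨ QP.+-identityˡ _ ⟩
  ∑ M (λ t → prefixIter (suc j) (suc t))        ≡⟨ ∑-cong M (λ t _ → prefixIter-binom j t) ⟩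
  ∑ M (λ t → ℕ→ℚ (t C j))                       ≡⟨ hockeyStick j M ⟩
  ℕ→ℚ (M C suc j)                               ∎
  where open ≡-Reasoning

∸-suc : ∀ n x → x N.< n → n ∸ x ≡ suc (n ∸ suc x)
∸-suc (suc n) zero _ = refl
∸-suc (suc n) (suc x) (s≤s x<n) = ∸-suc n x x<n

n-x-1≡n⊖1+x : ∀ n x → (ℤ.+ n) ℤ.- (ℤ.+ x) ℤ.- (ℤ.+ 1) ≡ n ℤ.⊖ suc x
n-x-1≡n⊖1+x n x = trans (cong (ℤ._- ℤ.+ 1) (ZP.m-n≡m⊖n n x))
  (trans (ZP.distribˡ-⊖-+-neg 0 n x) (cong (λ t → n ℤ.⊖ suc t) (NP.+-identityʳ x)))

shift-prefixIter : ∀ x n j → shift x (prefixIter (suc j)) n ≡ binomℤ ((ℤ.+ n) ℤ.- (ℤ.+ x) ℤ.- (ℤ.+ 1)) j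
shift-prefixIter x n j rewrite n-x-1≡n⊖1+x n x with suc x ≤? n
... | yes x<n rewrite ZP.⊖-≥ x<n | ∸-suc n x x<n =
  trans (cong₂ _*_ (χ-yes (NP.<⇒≤ x<n) (x ≤? n)) (prefixIter-binom j (n ∸ suc x))) (QP.*-identityˡ _)
... | no x≮n rewrite ZP.⊖-< (NP.≰⇒> x≮n)
                   | NP.+-∸-assoc 1 (NP.≤-pred (NP.≰⇒> x≮n))
                   | NP.m≤n⇒m∸n≡0 (NP.≤-pred (NP.≰⇒> x≮n)) = QP.*-zeroʳ (χ (x ≤? n))

shift-δ : ∀ n x → shift x (prefixIter 0) n ≡ δ n x
shift-δ n x with x ≤? n | n ≟ x
... | yes x≤n | yes n≡x = trans (QP.*-identityˡ _) (χ-yes (sym (trans (cong (_∸ x) n≡x) (NP.n∸n≡0 x))) (0 ≟ n ∸ x))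
... | yes x≤n | no n≢x = trans (QP.*-identityˡ _) (χ-no (λ e → n≢x (NP.≤-antisym (NP.m∸n≡0⇒m≤n (sym e)) x≤n)) (0 ≟ n ∸ x))
... | no x≰n | yes n≡x = ⊥-elim (x≰n (NP.≤-reflexive (sym n≡x)))
... | no x≰n | no _ = QP.*-zeroˡ (χ (0 ≟ n ∸ x))

-- The inclusion–exclusion sum is the bracket of the statement: the terms κ < k
-- are binomial coefficients, the term κ = k is (−1)^k δ_{n, Lk}.
inclExcl≡rhs : ∀ L k n → inclExcl L k n ≡
  sumBelow k (λ κ → sign κ * ℕ→ℚ (k C κ) * binomℤ ((ℤ.+ n) ℤ.- (ℤ.+ (L N.* κ)) ℤ.- (ℤ.+ 1)) (k ∸ κ ∸ 1))
  + sign k * δ n (L N.* k)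
inclExcl≡rhs L k n = begin
  ∑ (suc k) h
    ≡⟨ ∑-last k h ⟩
  ∑ k h + h k
    ≡⟨ cong₂ _+_ (∑-cong k (λ κ κ<k → cong (sign κ * ℕ→ℚ (k C κ) *_) (binomialTerm κ κ<k))) lastTerm ⟩
  ∑ k F + sign k * δ n (L N.* k)
    ≡⟨ cong (_+ sign k * δ n (L N.* k)) (sym (listSum-upTo F k)) ⟩
  sumBelow k F + sign k * δ n (L N.* k) ∎
  where
  open ≡-Reasoning
  h F : ℕ → ℚ
  h κ = sign κ * ℕ→ℚ (k C κ) * shift (L N.* κ) (prefixIter (k ∸ κ)) n
  F κ = sign κ * ℕ→ℚ (k C κ) * binomℤ ((ℤ.+ n) ℤ.- (ℤ.+ (L N.* κ)) ℤ.- (ℤ.+ 1)) (k ∸ κ ∸ 1)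
  binomialTerm : ∀ κ → κ N.< k → shift (L N.* κ) (prefixIter (k ∸ κ)) n
                                   ≡ binomℤ ((ℤ.+ n) ℤ.- (ℤ.+ (L N.* κ)) ℤ.- (ℤ.+ 1)) (k ∸ κ ∸ 1)
  binomialTerm κ κ<k = begin
    shift (L N.* κ) (prefixIter (k ∸ κ)) n
      ≡⟨ cong (λ t → shift (L N.* κ) (prefixIter t) n) (∸-suc k κ κ<k) ⟩
    shift (L N.* κ) (prefixIter (suc (k ∸ suc κ))) n
      ≡⟨ shift-prefixIter (L N.* κ) n (k ∸ suc κ) ⟩
    binomℤ ((ℤ.+ n) ℤ.- (ℤ.+ (L N.* κ)) ℤ.- (ℤ.+ 1)) (k ∸ suc κ)
      ≡⟨ cong (λ t → binomℤ ((ℤ.+ n) ℤ.- (ℤ.+ (L N.* κ)) ℤ.- (ℤ.+ 1)) (t ∸ 1)) (sym (∸-suc k κ κ<k)) ⟩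
    binomℤ ((ℤ.+ n) ℤ.- (ℤ.+ (L N.* κ)) ℤ.- (ℤ.+ 1)) (k ∸ κ ∸ 1) ∎
  lastTerm : h k ≡ sign k * δ n (L N.* k)
  lastTerm = begin
    sign k * ℕ→ℚ (k C k) * shift (L N.* k) (prefixIter (k ∸ k)) n
      ≡⟨ cong₂ (λ c j → sign k * ℕ→ℚ c * shift (L N.* k) (prefixIter j) n) (nCn≡1 k) (NP.n∸n≡0 k) ⟩
    sign k * 1ℚ * shift (L N.* k) (prefixIter 0) n
      ≡⟨ cong₂ _*_ (QP.*-identityʳ (sign k)) (shift-δ n (L N.* k)) ⟩
    sign k * δ n (L N.* k) ∎

bell≡powCoeff : ∀ z n k → k ≤ n → bell n k z ≡ ℕ→ℚ (n N.!) * invFact k * powCoeff z k n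
bell≡powCoeff z n k k≤n = begin
  bell n k z
    ≡⟨ bell≡slotSum n k z ⟩
  n! * U
    ≡⟨ cong (n! *_) (sym (trans (cong (λ t → t * U) (invFact-cancel k)) (QP.*-identityˡ U))) ⟩
  n! * (invFact k * ℕ→ℚ (k N.!) * U)
    ≡⟨ cong (n! *_) (QP.*-assoc (invFact k) (ℕ→ℚ (k N.!)) U) ⟩
  n! * (invFact k * (ℕ→ℚ (k N.!) * U))
    ≡⟨ cong (λ t → n! * (invFact k * t)) (slotSum≡powCoeff z (suc n ∸ k) n k n k≤n n<slots+k) ⟩
  n! * (invFact k * powCoeff z k n)
    ≡⟨ sym (QP.*-assoc n! (invFact k) (powCoeff z k n)) ⟩
  n! * invFact k * powCoeff z k n ∎
  where
  open ≡-Reasoning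
  n! = ℕ→ℚ (n N.!)
  U = slotSum z 1 (suc n ∸ k) n k n
  n<slots+k : n N.< (suc n ∸ k) N.+ k
  n<slots+k = subst (n N.<_) (sym (NP.m∸n+n≡m (NP.m≤n⇒m≤1+n k≤n))) (NP.n<1+n n)

mainTheorem6 : (ℓ n k : ℕ) → 1 ≤ k → k ≤ n →
    bell n k (zSeq ℓ) ≡ rhs ℓ n k
mainTheorem6 ℓ n k _ k≤n = begin
  bell n k (zSeq ℓ)                  ≡⟨ bell≡powCoeff (zSeq ℓ) n k k≤n ⟩
  c * powCoeff (zSeq ℓ) k n          ≡⟨ cong (c *_) (sym (inclExcl≡powCoeff ℓ k n)) ⟩
  c * inclExcl (suc ℓ) k n           ≡⟨ cong (c *_) (inclExcl≡rhs (suc ℓ) k n) ⟩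
  rhs ℓ n k                          ∎
  where
  open ≡-Reasoning
  c : ℚ
  c = ℕ→ℚ (n N.!) * invFact k
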